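{- (Support extension, left.) In $LG^\omega$, let $\Pi$ be a proof of $\Sigma,h;B[h\,\vec a/x],\Gamma\vdash C$, where $\{\vec a\}=supp(B)$, $h\notin\Sigma$, and $h$ is not free in $\Gamma$, $B$ and $C$. Let $\vec c$ be a list of nominal constants not in the support of $B$. Then there exists a proof $\Pi'$ of $\Sigma,h';B[h'\,\vec a\,\vec c/x],\Gamma\vdash C$, where $h'\notin\Sigma$ (and $h'$ is a variable of the type of $x$ raised over the types of $\vec a$ and $\vec c$).
   Context: Logic $LG^\omega$. Terms: Church's simply typed $\lambda$-calculus; formulas have type $o$; quantifier types do not contain $o$. There are distinguished nominal types, each with infinitely many nominal constants, plus a set $\mathcal K$ of other constants. A permutation $\pi$ is a finite type-preserving bijection on nominal constants, acting on terms by $\pi.t$. $supp(t)$ = set of nominal constants in $t$. $\Sigma$-substitutions map variables to terms with no nominal constants. A variable $h$ applied to nominal constants $c_1{:}\iota_1,\dots,c_n{:}\iota_n$ in place of $x:\tau$ has type $\iota_1\to\dots\to\iota_n\to\tau$ ("raising"). Sequents: $\Sigma;\Gamma\vdash C$, $\Gamma$ a multiset, free variables among $\Sigma$. Rules: $id_\pi$ ($\Sigma;\Gamma,B\vdash B'$ if $\pi.B=\pi'.B'$ for some permutations); multicut $mc$ (from $\Sigma;\Delta_i\vdash B_i$, $i=1..n$, and $\Sigma;B_1..B_n,\Gamma\vdash C$ infer $\Sigma;\Delta_1..\Delta_n,\Gamma\vdash C$); contraction; $\bot L$, $\top R$; usual $\land,\lor,\supset$ rules; $\forall L$, $\exists R$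 instantiate with any well-typed term over $\Sigma$, $\mathcal K$ and nominal constants; $\forall R$ (resp. $\exists L$): from $\Sigma,h;\Gamma\vdash B[h\,\vec c/x]$ infer $\Sigma;\Gamma\vdash\forall x.B$ (dually on the left for $\exists$), $h\notin\Sigma$, $\vec c$ listing $supp(B)$, $h$ raised over $\vec c$; $\nabla L,\nabla R$: replace the $\nabla$-bound variable (of nominal type) by a nominal constant $a\notin supp(B)$; $eqR$: $\Sigma;\Gamma\vdash t=t$; $eqL$: from premises $\Sigma\theta;\Gamma\theta\vdash C\theta$ for every $\Sigma$-substitution $\theta$ with $(\lambda\vec c.s)\theta=_{\beta\eta}(\lambda\vec c.t)\theta$, $\vec c$ listing $supp(s=t)$, infer $\Sigma;\Gamma,s=t\vdash C$; $defL/defR$: unfold an atom $p\,\vec t$ to $B[\vec t/\vec x]$ for a stratified definition clause $\forall\vec x.p\,\vec x\stackrel{\triangle}{=}B$ (body level $\le$ level of $p$, implication raising the level of its antecedent by one, body free of nominal constants); $natR$: $\vdash nat\,z$, and from $\Gamma\vdash nat\,I$ infer $\Gamma\vdash nat\,(s\,I)$; $natL$: from $\vdash D\,z$, $j;D\,j\vdash D\,(s\,j)$ and $\Sigma;\Gamma,D\,I\vdash C$ infer $\Sigma;\Gamma,nat\,I\vdash C$. -}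

module Defs where

open import Data.Nat using (ℕ; zero; suc; _≤_; _⊔_; _≟_)
open import Data.Bool using (Bool; true; false; _∧_; if_then_else_)
open import Data.Product using (_×_; _,_; Σ-syntax; ∃-syntax)
open import Data.Sum using (_⊎_)
open import Data.Empty using (⊥)
open import Data.Unit using (⊤)
open import Data.List using (List; []; _∷_; map; _++_; concat)
open import Data.List.Relation.Unary.All using (All)
open import Data.List.Relation.Unary.Unique.Propositional using (Unique)
open import Data.List.Membership.Propositional using (_∈_)
open import Data.List.Relation.Binary.Permutation.Propositional using (_↭_)
open import Data.List.Relation.Binary.Pointwise using (Pointwise)
open import Relation.Nullary using (¬_; yes; no)
open import Relation.Binary.PropositionalEquality using (_≡_; refl; subst)
open import Function.Bundles using (_⇔_)

data Ty : Set where
  nom  : ℕ → Ty          -- the distinguished nominal types ι_0, ι_1, ...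
  base : ℕ → Ty
  o    : Ty
  natT : Ty              -- the type of z and s (argument type of nat)
  _⇒_  : Ty → Ty → Ty

infixr 7 _⇒_

oFree : Ty → Bool
oFree (nom _)  = true
oFree (base _) = true
oFree o        = false
oFree natT     = true
oFree (σ ⇒ τ)  = oFree σ ∧ oFree τ

OFree : Ty → Set
OFree τ = oFree τ ≡ true

Ctx : Set
Ctx = List Ty

data _∋_ : Ctx → Ty → Set where
  here  : ∀ {Γ τ} → (τ ∷ Γ) ∋ τ
  there : ∀ {Γ σ τ} → Γ ∋ τ → (σ ∷ Γ) ∋ τ

-- nominal constants: (index of nominal type , name); constant (i , n) : nom i
NC : Set
NC = ℕ × ℕ

raise : List NC → Ty → Ty
raise []            τ = τ
raise ((i , _) ∷ cs) τ = nom i ⇒ raise cs τ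

arrows : List Ty → Ty → Ty
arrows []       τ = τ
arrows (σ ∷ σs) τ = σ ⇒ arrows σs τ

record Sig : Set₁ where
  field
    K   : Set
    kty : K → Ty

module LG (S : Sig) where
  open Sig S

  data Tm (Γ : Ctx) : Ty → Set where
    var   : ∀ {τ} → Γ ∋ τ → Tm Γ τ
    con   : (k : K) → Tm Γ (kty k)
    nc    : (i n : ℕ) → Tm Γ (nom i)
    lam   : ∀ {σ τ} → Tm (σ ∷ Γ) τ → Tm Γ (σ ⇒ τ)
    app   : ∀ {σ τ} → Tm Γ (σ ⇒ τ) → Tm Γ σ → Tm Γ τ
    top   : Tm Γ o
    bot   : Tm Γ o
    and   : Tm Γ (o ⇒ o ⇒ o)
    or    : Tm Γ (o ⇒ o ⇒ o)
    imp   : Tm Γ (o ⇒ o ⇒ o)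
    all   : (τ : Ty) → OFree τ → Tm Γ ((τ ⇒ o) ⇒ o)
    ex    : (τ : Ty) → OFree τ → Tm Γ ((τ ⇒ o) ⇒ o)
    nabla : (i : ℕ) → Tm Γ ((nom i ⇒ o) ⇒ o)
    eq    : (τ : Ty) → OFree τ → Tm Γ (τ ⇒ τ ⇒ o)
    nat   : Tm Γ (natT ⇒ o)
    zc    : Tm Γ natT
    sc    : Tm Γ (natT ⇒ natT)

  Fm : Ctx → Set
  Fm Γ = Tm Γ o

  Ren : Ctx → Ctx → Set
  Ren Γ Δ = ∀ {τ} → Γ ∋ τ → Δ ∋ τ

  ext : ∀ {Γ Δ σ} → Ren Γ Δ → Ren (σ ∷ Γ) (σ ∷ Δ)
  ext ρ here      = here
  ext ρ (there x) = there (ρ x)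

  ren : ∀ {Γ Δ τ} → Ren Γ Δ → Tm Γ τ → Tm Δ τ
  ren ρ (var x)     = var (ρ x)
  ren ρ (con k)     = con k
  ren ρ (nc i n)    = nc i n
  ren ρ (lam t)     = lam (ren (ext ρ) t)
  ren ρ (app t u)   = app (ren ρ t) (ren ρ u)
  ren ρ top         = top
  ren ρ bot         = bot
  ren ρ and         = and
  ren ρ or          = or
  ren ρ imp         = imp
  ren ρ (all τ p)   = all τ p
  ren ρ (ex τ p)    = ex τ p
  ren ρ (nabla i)   = nabla i
  ren ρ (eq τ p)    = eq τ p
  ren ρ nat         = nat
  ren ρ zc          = zc
  ren ρ sc          = sc

  wk : ∀ {Γ σ τ} → Tm Γ τ → Tm (σ ∷ Γ) τ
  wk = ren there

  wk₀ : ∀ {Γ τ} → Tm [] τ → Tm Γ τ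
  wk₀ = ren (λ ())

  Sub : Ctx → Ctx → Set
  Sub Γ Δ = ∀ {τ} → Γ ∋ τ → Tm Δ τ

  exts : ∀ {Γ Δ σ} → Sub Γ Δ → Sub (σ ∷ Γ) (σ ∷ Δ)
  exts θ here      = var here
  exts θ (there x) = wk (θ x)

  sub : ∀ {Γ Δ τ} → Sub Γ Δ → Tm Γ τ → Tm Δ τ
  sub θ (var x)     = θ x
  sub θ (con k)     = con k
  sub θ (nc i n)    = nc i n
  sub θ (lam t)     = lam (sub (exts θ) t)
  sub θ (app t u)   = app (sub θ t) (sub θ u)
  sub θ top         = top
  sub θ bot         = bot
  sub θ and         = and
  sub θ or          = or
  sub θ imp         = imp
  sub θ (all τ p)   = all τ p
  sub θ (ex τ p)    = ex τ p
  sub θ (nabla i)   = nabla i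
  sub θ (eq τ p)    = eq τ p
  sub θ nat         = nat
  sub θ zc          = zc
  sub θ sc          = sc

  single : ∀ {Γ σ} → Tm Γ σ → Sub (σ ∷ Γ) Γ
  single u here      = u
  single u (there x) = var x

  data _≈_ {Γ : Ctx} : ∀ {τ} → Tm Γ τ → Tm Γ τ → Set where
    ≈refl  : ∀ {τ} {t : Tm Γ τ} → t ≈ t
    ≈sym   : ∀ {τ} {t u : Tm Γ τ} → t ≈ u → u ≈ t
    ≈trans : ∀ {τ} {t u v : Tm Γ τ} → t ≈ u → u ≈ v → t ≈ v
    ≈app   : ∀ {σ τ} {t t' : Tm Γ (σ ⇒ τ)} {u u' : Tm Γ σ} →
             t ≈ t' → u ≈ u' → app t u ≈ app t' u'
    ≈lam   : ∀ {σ τ} {t t' : Tm (σ ∷ Γ) τ} → t ≈ t' → lam t ≈ lam t'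
    ≈β     : ∀ {σ τ} (t : Tm (σ ∷ Γ) τ) (u : Tm Γ σ) →
             app (lam t) u ≈ sub (single u) t
    ≈η     : ∀ {σ τ} (t : Tm Γ (σ ⇒ τ)) → t ≈ lam (app (wk t) (var here))

  data Occ (c : NC) {Γ : Ctx} : ∀ {τ} → Tm Γ τ → Set where
    occ-nc   : ∀ {i n} → c ≡ (i , n) → Occ c (nc i n)
    occ-lam  : ∀ {σ τ} {t : Tm (σ ∷ Γ) τ} → Occ c t → Occ c (lam t)
    occ-appˡ : ∀ {σ τ} {t : Tm Γ (σ ⇒ τ)} {u : Tm Γ σ} → Occ c t → Occ c (app t u)
    occ-appʳ : ∀ {σ τ} {t : Tm Γ (σ ⇒ τ)} {u : Tm Γ σ} → Occ c u → Occ c (app t u)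

  -- support of a term considered up to lambda-conversion:
  -- c ∈ supp(t) iff c occurs in every term convertible with t
  -- (equivalently, in the beta-eta normal form of t)
  InSupp : ∀ {Γ τ} → NC → Tm Γ τ → Set
  InSupp c t = ∀ t' → t ≈ t' → Occ c t'

  Supp : ∀ {Γ τ} → Tm Γ τ → List NC → Set
  Supp t cs = Unique cs × (∀ c → (c ∈ cs) ⇔ InSupp c t)

  NoNom : ∀ {Γ τ} → Tm Γ τ → Set
  NoNom t = ∀ c → ¬ InSupp c t

  record Perm : Set where
    field
      fun  : ℕ → ℕ → ℕ      -- fun i : bijection on the names of type nom i
      inv  : ℕ → ℕ → ℕ
      inv-fun : ∀ i n → inv i (fun i n) ≡ n
      fun-inv : ∀ i n → fun i (inv i n) ≡ n
      finite  : ∃[ N ] (∀ i n → (N ≤ i ⊎ N ≤ n) → fun i n ≡ n)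

  perm : ∀ {Γ τ} → Perm → Tm Γ τ → Tm Γ τ
  perm π (var x)     = var x
  perm π (con k)     = con k
  perm π (nc i n)    = nc i (Perm.fun π i n)
  perm π (lam t)     = lam (perm π t)
  perm π (app t u)   = app (perm π t) (perm π u)
  perm π top         = top
  perm π bot         = bot
  perm π and         = and
  perm π or          = or
  perm π imp         = imp
  perm π (all τ p)   = all τ p
  perm π (ex τ p)    = ex τ p
  perm π (nabla i)   = nabla i
  perm π (eq τ p)    = eq τ p
  perm π nat         = nat
  perm π zc          = zc
  perm π sc          = sc

  applyNC : ∀ {Γ τ} (cs : List NC) → Tm Γ (raise cs τ) → Tm Γ τ
  applyNC []            t = t
  applyNC ((i , n) ∷ cs) t = applyNC cs (app t (nc i n))

  -- B[h cs / x] where h is the newest variable of the context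
  instSub : ∀ {Σ τ} (cs : List NC) → Sub (τ ∷ Σ) (raise cs τ ∷ Σ)
  instSub cs here      = applyNC cs (var here)
  instSub cs (there x) = var (there x)

  inst : ∀ {Σ τ σ} (cs : List NC) → Tm (τ ∷ Σ) σ → Tm (raise cs τ ∷ Σ) σ
  inst cs = sub (instSub cs)

  absAt : ∀ {Γ Δ τ} (i n : ℕ) → Ren Γ Δ → Δ ∋ nom i → Tm Γ τ → Tm Δ τ
  absAt i n ρ x (var y)    = var (ρ y)
  absAt i n ρ x (con k)    = con k
  absAt i n ρ x (nc j m) with j ≟ i | m ≟ n
  ... | yes refl | yes refl = var x
  ... | _        | _        = nc j m
  absAt i n ρ x (lam t)    = lam (absAt i n (ext ρ) (there x) t)
  absAt i n ρ x (app t u)  = app (absAt i n ρ x t) (absAt i n ρ x u)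
  absAt i n ρ x top        = top
  absAt i n ρ x bot        = bot
  absAt i n ρ x and        = and
  absAt i n ρ x or         = or
  absAt i n ρ x imp        = imp
  absAt i n ρ x (all τ p)  = all τ p
  absAt i n ρ x (ex τ p)   = ex τ p
  absAt i n ρ x (nabla j)  = nabla j
  absAt i n ρ x (eq τ p)   = eq τ p
  absAt i n ρ x nat        = nat
  absAt i n ρ x zc         = zc
  absAt i n ρ x sc         = sc

  abstr : ∀ {Γ τ} (cs : List NC) → Tm Γ τ → Tm Γ (raise cs τ)
  abstr []            t = t
  abstr ((i , n) ∷ cs) t = lam (absAt i n there here (abstr cs t))

  spine : ∀ {Γ σ} (Δ : Ctx) → (∀ {τ} → Δ ∋ τ → Γ ∋ τ) → Tm Γ (arrows Δ σ) → Tm Γ σ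
  spine []      f t = t
  spine (τ ∷ Δ) f t = spine Δ (λ x → f (there x)) (app t (var (f here)))

  AllOFree : Ctx → Set
  AllOFree Γ = All OFree Γ

  record Clause : Set where
    field
      pred   : K
      args   : Ctx
      argsOF : AllOFree args
      ptype  : kty pred ≡ arrows args o
      body   : Fm args

    head : Fm args
    head = spine args (λ x → x) (subst (Tm args) ptype (con pred))

  -- levels of formulas (implication raises the level of its antecedent)
  isImp : ∀ {Γ τ} → Tm Γ τ → Bool
  isImp imp = true
  isImp _   = false

  mutual
    level : (K → ℕ) → ∀ {Γ τ} → Tm Γ τ → ℕ
    level lv (app t u) = levelApp lv t (level lv u)
    level lv (lam t)   = level lv t
    level lv (con k)   = lv k
    level lv _         = 0

    -- level of (t u) given the level m of u; (imp A) u is A ⊃ u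
    levelApp : (K → ℕ) → ∀ {Γ τ} → Tm Γ τ → ℕ → ℕ
    levelApp lv (app f A) m =
      if isImp f then suc (level lv A) ⊔ m else (level lv f ⊔ level lv A) ⊔ m
    levelApp lv t m = level lv t ⊔ m

  record DefSet : Set₁ where
    field
      Idx        : Set
      clause     : Idx → Clause
      lv         : K → ℕ
      stratified : ∀ d → level lv (Clause.body (clause d)) ≤ lv (Clause.pred (clause d))
      bodyNoNom  : ∀ d → NoNom (Clause.body (clause d))

  infixl 9 _·_
  _·_ : ∀ {Γ σ τ} → Tm Γ (σ ⇒ τ) → Tm Γ σ → Tm Γ τ
  _·_ = app

  module Rules (D : DefSet) where
    open DefSet D

    data Der (Σ : Ctx) : List (Fm Σ) → Fm Σ → Set where
      -- formulas are taken up to lambda-conversion, Γ up to reordering (multiset)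
      conv  : ∀ {Γ Γ' C C'} → Pointwise _≈_ Γ Γ' → C ≈ C' → Der Σ Γ C → Der Σ Γ' C'
      exch  : ∀ {Γ Γ' C} → Γ ↭ Γ' → Der Σ Γ C → Der Σ Γ' C
      idπ   : ∀ {Γ B B'} (π π' : Perm) → perm π B ≈ perm π' B' → Der Σ (B ∷ Γ) B'
      mc    : ∀ {Γ C} (ps : List (List (Fm Σ) × Fm Σ)) →
              All (λ { (Δ , B) → Der Σ Δ B }) ps →
              Der Σ (map (λ { (_ , B) → B }) ps ++ Γ) C →
              Der Σ (concat (map (λ { (Δ , _) → Δ }) ps) ++ Γ) C
      contr : ∀ {Γ B C} → Der Σ (B ∷ B ∷ Γ) C → Der Σ (B ∷ Γ) C
      botL  : ∀ {Γ C} → Der Σ (bot ∷ Γ) C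
      topR  : ∀ {Γ} → Der Σ Γ top
      andL₁ : ∀ {Γ B B' C} → Der Σ (B ∷ Γ) C → Der Σ (and · B · B' ∷ Γ) C
      andL₂ : ∀ {Γ B B' C} → Der Σ (B' ∷ Γ) C → Der Σ (and · B · B' ∷ Γ) C
      andR  : ∀ {Γ B B'} → Der Σ Γ B → Der Σ Γ B' → Der Σ Γ (and · B · B')
      orL   : ∀ {Γ B B' C} → Der Σ (B ∷ Γ) C → Der Σ (B' ∷ Γ) C → Der Σ (or · B · B' ∷ Γ) C
      orR₁  : ∀ {Γ B B'} → Der Σ Γ B → Der Σ Γ (or · B · B')
      orR₂  : ∀ {Γ B B'} → Der Σ Γ B' → Der Σ Γ (or · B · B')
      impL  : ∀ {Γ B B' C} → Der Σ Γ B → Der Σ (B' ∷ Γ) C → Der Σ (imp · B · B' ∷ Γ) C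
      impR  : ∀ {Γ B B'} → Der Σ (B ∷ Γ) B' → Der Σ Γ (imp · B · B')
      -- M is (λx.B); M · t is B[t/x] up to beta
      allL  : ∀ {Γ C τ p} {M : Tm Σ (τ ⇒ o)} (t : Tm Σ τ) →
              Der Σ (M · t ∷ Γ) C → Der Σ (all τ p · M ∷ Γ) C
      exR   : ∀ {Γ τ p} {M : Tm Σ (τ ⇒ o)} (t : Tm Σ τ) →
              Der Σ Γ (M · t) → Der Σ Γ (ex τ p · M)
      allR  : ∀ {Γ τ p} {M : Tm Σ (τ ⇒ o)} (cs : List NC) → Supp M cs →
              Der (raise cs τ ∷ Σ) (map wk Γ) (wk M · applyNC cs (var here)) →
              Der Σ Γ (all τ p · M)
      exL   : ∀ {Γ C τ p} {M : Tm Σ (τ ⇒ o)} (cs : List NC) → Supp M cs →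
              Der (raise cs τ ∷ Σ) (wk M · applyNC cs (var here) ∷ map wk Γ) (wk C) →
              Der Σ (ex τ p · M ∷ Γ) C
      nablaL : ∀ {Γ C i} {M : Tm Σ (nom i ⇒ o)} (a : ℕ) → ¬ InSupp (i , a) M →
              Der Σ (M · nc i a ∷ Γ) C → Der Σ (nabla i · M ∷ Γ) C
      nablaR : ∀ {Γ i} {M : Tm Σ (nom i ⇒ o)} (a : ℕ) → ¬ InSupp (i , a) M →
              Der Σ Γ (M · nc i a) → Der Σ Γ (nabla i · M)
      eqR   : ∀ {Γ τ p} (t : Tm Σ τ) → Der Σ Γ (eq τ p · t · t)
      eqL   : ∀ {Γ C τ p} (s t : Tm Σ τ) (cs : List NC) → Supp (eq τ p · s · t) cs →
              (∀ (Σ' : Ctx) → AllOFree Σ' → (θ : Sub Σ Σ') →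
                 (∀ {υ} (x : Σ ∋ υ) → NoNom (θ x)) →
                 sub θ (abstr cs s) ≈ sub θ (abstr cs t) →
                 Der Σ' (map (sub θ) Γ) (sub θ C)) →
              Der Σ (eq τ p · s · t ∷ Γ) C
      defL  : ∀ {Γ C} (d : Idx) (σ : Sub (Clause.args (clause d)) Σ) →
              Der Σ (sub σ (Clause.body (clause d)) ∷ Γ) C →
              Der Σ (sub σ (Clause.head (clause d)) ∷ Γ) C
      defR  : ∀ {Γ} (d : Idx) (σ : Sub (Clause.args (clause d)) Σ) →
              Der Σ Γ (sub σ (Clause.body (clause d))) →
              Der Σ Γ (sub σ (Clause.head (clause d)))
      natR₀ : ∀ {Γ} → Der Σ Γ (nat · zc)
      natRs : ∀ {Γ I} → Der Σ Γ (nat · I) → Der Σ Γ (nat · (sc · I))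
      natL  : ∀ {Γ C I} (Dn : Tm [] (natT ⇒ o)) →
              Der [] [] (Dn · zc) →
              Der (natT ∷ []) (wk Dn · var here ∷ []) (wk Dn · (sc · var here)) →
              Der Σ (wk₀ Dn · I ∷ Γ) C →
              Der Σ (nat · I ∷ Γ) C

-- B[h' ā c̄/x] ⊢ ∃x.B holds by ∃R with witness h' ā c̄, and ∃x.B, Γ ⊢ C holds by ∃L
-- whose eigenvariable, raised over ā = supp(B), plays the role of h: its premise is Π
-- weakened by h'. A cut on ∃x.B gives the claim.
module Submission where

open import Defs
open import Data.List using (List; []; _∷_; map; _++_; concat)
open import Data.List.Properties using (map-++; map-∘; map-cong; concat-map)
open import Data.List.Relation.Unary.All using (All; []; _∷_)
open import Data.List.Relation.Binary.Pointwise as Pointwise using (_∷_)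
open import Data.List.Relation.Binary.Permutation.Propositional.Properties using (map⁺)
open import Data.Nat using (ℕ; _≟_)
open import Data.Product as Prod using (_×_; _,_; proj₁; proj₂)
open import Data.Empty using (⊥-elim)
open import Function using (_∘_)
open import Function.Bundles using (_⇔_; mk⇔; Equivalence)
open import Relation.Nullary using (¬_; yes; no)
open import Relation.Binary.PropositionalEquality
  using (_≡_; refl; sym; trans; cong; cong₂; subst; subst₂; module ≡-Reasoning)

module _ {A B : Set} (f : A → B) where

  map-proj₂-++ : ∀ (ps : List (List A × A)) xs →
                 map f (map proj₂ ps ++ xs) ≡ map proj₂ (map (Prod.map (map f) f) ps) ++ map f xs
  map-proj₂-++ ps xs = trans (map-++ f (map proj₂ ps) xs) (cong (_++ _) (trans (sym (map-∘ ps)) (map-∘ ps)))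

  map-concat-proj₁-++ : ∀ (ps : List (List A × A)) xs →
                        map f (concat (map proj₁ ps) ++ xs) ≡ concat (map proj₁ (map (Prod.map (map f) f) ps)) ++ map f xs
  map-concat-proj₁-++ ps xs = begin
    map f (concat (map proj₁ ps) ++ xs)              ≡⟨ map-++ f (concat (map proj₁ ps)) xs ⟩
    map f (concat (map proj₁ ps)) ++ map f xs        ≡⟨ cong (_++ _) (sym (concat-map (map proj₁ ps))) ⟩
    concat (map (map f) (map proj₁ ps)) ++ map f xs  ≡⟨ cong (λ xss → concat xss ++ _) (trans (sym (map-∘ ps)) (map-∘ ps)) ⟩
    concat (map proj₁ (map (Prod.map (map f) f) ps)) ++ map f xs ∎
    where open ≡-Reasoning

module Metatheory (S : Sig) where
  open LG S

  ≡⇒≈ : ∀ {Γ τ} {t u : Tm Γ τ} → t ≡ u → t ≈ u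
  ≡⇒≈ refl = ≈refl

  ren-ren : ∀ {Γ Δ Ε τ} {ρ₁ : Ren Γ Δ} {ρ₂ : Ren Δ Ε} {ρ : Ren Γ Ε} →
            (∀ {υ} (x : Γ ∋ υ) → ρ₂ (ρ₁ x) ≡ ρ x) →
            (t : Tm Γ τ) → ren ρ₂ (ren ρ₁ t) ≡ ren ρ t
  ren-ren e (var x)   = cong var (e x)
  ren-ren e (lam t)   = cong lam (ren-ren (λ { here → refl ; (there x) → cong there (e x) }) t)
  ren-ren e (app t u) = cong₂ app (ren-ren e t) (ren-ren e u)
  ren-ren e (con _)   = refl
  ren-ren e (nc _ _)  = refl
  ren-ren e top       = refl
  ren-ren e bot       = refl
  ren-ren e and       = refl
  ren-ren e or        = refl
  ren-ren e imp       = refl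
  ren-ren e (all _ _) = refl
  ren-ren e (ex _ _)  = refl
  ren-ren e (nabla _) = refl
  ren-ren e (eq _ _)  = refl
  ren-ren e nat       = refl
  ren-ren e zc        = refl
  ren-ren e sc        = refl

  ren-ext-wk : ∀ {Γ Δ σ τ} (ρ : Ren Γ Δ) (t : Tm Γ τ) →
               ren (ext {σ = σ} ρ) (wk t) ≡ wk (ren ρ t)
  ren-ext-wk ρ t = trans (ren-ren (λ _ → refl) t) (sym (ren-ren (λ _ → refl) t))

  sub-ren : ∀ {Γ Δ Ε τ} {ρ : Ren Γ Δ} {θ₁ : Sub Δ Ε} {θ : Sub Γ Ε} →
            (∀ {υ} (x : Γ ∋ υ) → θ₁ (ρ x) ≡ θ x) →
            (t : Tm Γ τ) → sub θ₁ (ren ρ t) ≡ sub θ t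
  sub-ren e (var x)   = e x
  sub-ren e (lam t)   = cong lam (sub-ren (λ { here → refl ; (there x) → cong wk (e x) }) t)
  sub-ren e (app t u) = cong₂ app (sub-ren e t) (sub-ren e u)
  sub-ren e (con _)   = refl
  sub-ren e (nc _ _)  = refl
  sub-ren e top       = refl
  sub-ren e bot       = refl
  sub-ren e and       = refl
  sub-ren e or        = refl
  sub-ren e imp       = refl
  sub-ren e (all _ _) = refl
  sub-ren e (ex _ _)  = refl
  sub-ren e (nabla _) = refl
  sub-ren e (eq _ _)  = refl
  sub-ren e nat       = refl
  sub-ren e zc        = refl
  sub-ren e sc        = refl

  ren-sub : ∀ {Γ Δ Ε τ} {θ₁ : Sub Γ Δ} {ρ : Ren Δ Ε} {θ : Sub Γ Ε} →
            (∀ {υ} (x : Γ ∋ υ) → ren ρ (θ₁ x) ≡ θ x) →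
            (t : Tm Γ τ) → ren ρ (sub θ₁ t) ≡ sub θ t
  ren-sub e (var x)   = e x
  ren-sub {θ₁ = θ₁} {ρ} e (lam t) = cong lam (ren-sub exts-commute t)
    where
    exts-commute : ∀ {σ υ} (x : (σ ∷ _) ∋ υ) → ren (ext ρ) (exts θ₁ x) ≡ exts _ x
    exts-commute here      = refl
    exts-commute (there x) = trans (ren-ext-wk ρ (θ₁ x)) (cong wk (e x))
  ren-sub e (app t u) = cong₂ app (ren-sub e t) (ren-sub e u)
  ren-sub e (con _)   = refl
  ren-sub e (nc _ _)  = refl
  ren-sub e top       = refl
  ren-sub e bot       = refl
  ren-sub e and       = refl
  ren-sub e or        = refl
  ren-sub e imp       = refl
  ren-sub e (all _ _) = refl
  ren-sub e (ex _ _)  = refl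
  ren-sub e (nabla _) = refl
  ren-sub e (eq _ _)  = refl
  ren-sub e nat       = refl
  ren-sub e zc        = refl
  ren-sub e sc        = refl

  sub-wk : ∀ {Γ Δ σ τ} (θ : Sub Γ Δ) (t : Tm Γ τ) →
           sub (exts {σ = σ} θ) (wk t) ≡ wk (sub θ t)
  sub-wk θ t = trans (sub-ren (λ _ → refl) t) (sym (ren-sub (λ _ → refl) t))

  sub-sub : ∀ {Γ Δ Ε τ} {θ₁ : Sub Γ Δ} {θ₂ : Sub Δ Ε} {θ : Sub Γ Ε} →
            (∀ {υ} (x : Γ ∋ υ) → sub θ₂ (θ₁ x) ≡ θ x) →
            (t : Tm Γ τ) → sub θ₂ (sub θ₁ t) ≡ sub θ t
  sub-sub e (var x)   = e x
  sub-sub {θ₁ = θ₁} {θ₂} e (lam t) = cong lam (sub-sub exts-commute t)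
    where
    exts-commute : ∀ {σ υ} (x : (σ ∷ _) ∋ υ) → sub (exts θ₂) (exts θ₁ x) ≡ exts _ x
    exts-commute here      = refl
    exts-commute (there x) = trans (sub-wk θ₂ (θ₁ x)) (cong wk (e x))
  sub-sub e (app t u) = cong₂ app (sub-sub e t) (sub-sub e u)
  sub-sub e (con _)   = refl
  sub-sub e (nc _ _)  = refl
  sub-sub e top       = refl
  sub-sub e bot       = refl
  sub-sub e and       = refl
  sub-sub e or        = refl
  sub-sub e imp       = refl
  sub-sub e (all _ _) = refl
  sub-sub e (ex _ _)  = refl
  sub-sub e (nabla _) = refl
  sub-sub e (eq _ _)  = refl
  sub-sub e nat       = refl
  sub-sub e zc        = refl
  sub-sub e sc        = refl

  sub-id : ∀ {Γ τ} {θ : Sub Γ Γ} → (∀ {υ} (x : Γ ∋ υ) → θ x ≡ var x) →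
           (t : Tm Γ τ) → sub θ t ≡ t
  sub-id e (var x)   = e x
  sub-id e (lam t)   = cong lam (sub-id (λ { here → refl ; (there x) → cong wk (e x) }) t)
  sub-id e (app t u) = cong₂ app (sub-id e t) (sub-id e u)
  sub-id e (con _)   = refl
  sub-id e (nc _ _)  = refl
  sub-id e top       = refl
  sub-id e bot       = refl
  sub-id e and       = refl
  sub-id e or        = refl
  sub-id e imp       = refl
  sub-id e (all _ _) = refl
  sub-id e (ex _ _)  = refl
  sub-id e (nabla _) = refl
  sub-id e (eq _ _)  = refl
  sub-id e nat       = refl
  sub-id e zc        = refl
  sub-id e sc        = refl

  ren-≈ : ∀ {Γ Δ τ} (ρ : Ren Γ Δ) {t u : Tm Γ τ} → t ≈ u → ren ρ t ≈ ren ρ u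
  ren-≈ ρ ≈refl          = ≈refl
  ren-≈ ρ (≈sym e)       = ≈sym (ren-≈ ρ e)
  ren-≈ ρ (≈trans e e')  = ≈trans (ren-≈ ρ e) (ren-≈ ρ e')
  ren-≈ ρ (≈app e e')    = ≈app (ren-≈ ρ e) (ren-≈ ρ e')
  ren-≈ ρ (≈lam e)       = ≈lam (ren-≈ (ext ρ) e)
  ren-≈ ρ (≈β t u)       = ≈trans (≈β (ren (ext ρ) t) (ren ρ u))
    (≡⇒≈ (trans (sub-ren (λ { here → refl ; (there x) → refl }) t) (sym (ren-sub (λ _ → refl) t))))
  ren-≈ ρ (≈η t)         = ≈trans (≈η (ren ρ t))
    (≡⇒≈ (cong (λ t' → lam (app t' (var here))) (sym (ren-ext-wk ρ t))))

  sub-≈ : ∀ {Γ Δ τ} (θ : Sub Γ Δ) {t u : Tm Γ τ} → t ≈ u → sub θ t ≈ sub θ u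
  sub-≈ θ ≈refl          = ≈refl
  sub-≈ θ (≈sym e)       = ≈sym (sub-≈ θ e)
  sub-≈ θ (≈trans e e')  = ≈trans (sub-≈ θ e) (sub-≈ θ e')
  sub-≈ θ (≈app e e')    = ≈app (sub-≈ θ e) (sub-≈ θ e')
  sub-≈ θ (≈lam e)       = ≈lam (sub-≈ (exts θ) e)
  sub-≈ θ (≈β t u)       = ≈trans (≈β (sub (exts θ) t) (sub θ u))
    (≡⇒≈ (trans (sub-sub single-exts t) (sym (sub-sub (λ _ → refl) t))))
    where
    single-exts : ∀ {υ} (x : _ ∋ υ) → sub (single (sub θ u)) (exts θ x) ≡ sub θ (single u x)
    single-exts here      = refl
    single-exts (there x) = trans (sub-ren (λ _ → refl) (θ x)) (sub-id (λ _ → refl) (θ x))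
  sub-≈ θ (≈η t)         = ≈trans (≈η (sub θ t))
    (≡⇒≈ (cong (λ t' → lam (app t' (var here))) (sym (sub-wk θ t))))

  occ-ren : ∀ {c Γ Δ τ} (ρ : Ren Γ Δ) (t : Tm Γ τ) → Occ c (ren ρ t) → Occ c t
  occ-ren ρ (nc _ _)  (occ-nc e)    = occ-nc e
  occ-ren ρ (lam t)   (occ-lam oc)  = occ-lam (occ-ren (ext ρ) t oc)
  occ-ren ρ (app t u) (occ-appˡ oc) = occ-appˡ (occ-ren ρ t oc)
  occ-ren ρ (app t u) (occ-appʳ oc) = occ-appʳ (occ-ren ρ u oc)

  occ-sub : ∀ {c Γ Δ τ} (θ : Sub Γ Δ) → (∀ {υ} (x : Γ ∋ υ) → ¬ Occ c (θ x)) →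
            (t : Tm Γ τ) → Occ c (sub θ t) → Occ c t
  occ-sub θ f (var x)   oc            = ⊥-elim (f x oc)
  occ-sub θ f (nc _ _)  (occ-nc e)    = occ-nc e
  occ-sub θ f (lam t)   (occ-lam oc)  =
    occ-lam (occ-sub (exts θ) (λ { here () ; (there x) oc → f x (occ-ren there (θ x) oc) }) t oc)
  occ-sub θ f (app t u) (occ-appˡ oc) = occ-appˡ (occ-sub θ f t oc)
  occ-sub θ f (app t u) (occ-appʳ oc) = occ-appʳ (occ-sub θ f u oc)

  perm-ren : ∀ {Γ Δ τ} (π : Perm) (ρ : Ren Γ Δ) (t : Tm Γ τ) → perm π (ren ρ t) ≡ ren ρ (perm π t)
  perm-ren π ρ (var x)   = refl
  perm-ren π ρ (lam t)   = cong lam (perm-ren π (ext ρ) t)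
  perm-ren π ρ (app t u) = cong₂ app (perm-ren π ρ t) (perm-ren π ρ u)
  perm-ren π ρ (con _)   = refl
  perm-ren π ρ (nc _ _)  = refl
  perm-ren π ρ top       = refl
  perm-ren π ρ bot       = refl
  perm-ren π ρ and       = refl
  perm-ren π ρ or        = refl
  perm-ren π ρ imp       = refl
  perm-ren π ρ (all _ _) = refl
  perm-ren π ρ (ex _ _)  = refl
  perm-ren π ρ (nabla _) = refl
  perm-ren π ρ (eq _ _)  = refl
  perm-ren π ρ nat       = refl
  perm-ren π ρ zc        = refl
  perm-ren π ρ sc        = refl

  idPerm : Perm
  idPerm = record
    { fun = λ _ n → n ; inv = λ _ n → n
    ; inv-fun = λ _ _ → refl ; fun-inv = λ _ _ → refl
    ; finite = 0 , λ _ _ _ → refl }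

  perm-id : ∀ {Γ τ} (t : Tm Γ τ) → perm idPerm t ≡ t
  perm-id (var x)   = refl
  perm-id (lam t)   = cong lam (perm-id t)
  perm-id (app t u) = cong₂ app (perm-id t) (perm-id u)
  perm-id (con _)   = refl
  perm-id (nc _ _)  = refl
  perm-id top       = refl
  perm-id bot       = refl
  perm-id and       = refl
  perm-id or        = refl
  perm-id imp       = refl
  perm-id (all _ _) = refl
  perm-id (ex _ _)  = refl
  perm-id (nabla _) = refl
  perm-id (eq _ _)  = refl
  perm-id nat       = refl
  perm-id zc        = refl
  perm-id sc        = refl

  ren-applyNC : ∀ {Γ Δ τ} (ρ : Ren Γ Δ) (cs : List NC) (t : Tm Γ (raise cs τ)) →
                ren ρ (applyNC cs t) ≡ applyNC cs (ren ρ t)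
  ren-applyNC ρ []             t = refl
  ren-applyNC ρ ((i , n) ∷ cs) t = ren-applyNC ρ cs (app t (nc i n))

  ren-absAt : ∀ {Γ Δ Γ' Δ' τ} (i n : ℕ) {ρ₁ : Ren Γ Δ} {ρ₂ : Ren Γ' Δ'} {ρ : Ren Δ Δ'} {ρ' : Ren Γ Γ'} →
              (∀ {υ} (y : Γ ∋ υ) → ρ (ρ₁ y) ≡ ρ₂ (ρ' y)) → (x : Δ ∋ nom i) (t : Tm Γ τ) →
              ren ρ (absAt i n ρ₁ x t) ≡ absAt i n ρ₂ (ρ x) (ren ρ' t)
  ren-absAt i n e x (var y)   = cong var (e y)
  ren-absAt i n e x (nc j m) with j ≟ i | m ≟ n
  ... | yes refl | yes refl = refl
  ... | yes refl | no _     = refl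
  ... | no _     | _        = refl
  ren-absAt i n e x (lam t)   =
    cong lam (ren-absAt i n (λ { here → refl ; (there y) → cong there (e y) }) (there x) t)
  ren-absAt i n e x (app t u) = cong₂ app (ren-absAt i n e x t) (ren-absAt i n e x u)
  ren-absAt i n e x (con _)   = refl
  ren-absAt i n e x top       = refl
  ren-absAt i n e x bot       = refl
  ren-absAt i n e x and       = refl
  ren-absAt i n e x or        = refl
  ren-absAt i n e x imp       = refl
  ren-absAt i n e x (all _ _) = refl
  ren-absAt i n e x (ex _ _)  = refl
  ren-absAt i n e x (nabla _) = refl
  ren-absAt i n e x (eq _ _)  = refl
  ren-absAt i n e x nat       = refl
  ren-absAt i n e x zc        = refl
  ren-absAt i n e x sc        = refl

  ren-abstr : ∀ {Γ Δ τ} (ρ : Ren Γ Δ) (cs : List NC) (t : Tm Γ τ) →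
              ren ρ (abstr cs t) ≡ abstr cs (ren ρ t)
  ren-abstr ρ []             t = refl
  ren-abstr ρ ((i , n) ∷ cs) t =
    cong lam (trans (ren-absAt i n (λ _ → refl) here (abstr cs t))
                    (cong (absAt i n there here) (ren-abstr ρ cs t)))

  NominalFree : ∀ {Γ τ} → Tm Γ τ → Set
  NominalFree t = ∀ c → ¬ Occ c t

  -- Support is defined through all convertible terms, not only renamed ones, so a
  -- renaming preserves it only if some substitution without nominal constants undoes it.
  record Weakening (Γ Δ : Ctx) : Set where
    field
      embed                : Ren Γ Δ
      retract              : Sub Δ Γ
      retract-embed        : ∀ {τ} (x : Γ ∋ τ) → retract (embed x) ≡ var x
      retract-nominal-free : ∀ {τ} (y : Δ ∋ τ) → NominalFree (retract y)

  open Weakening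

  Weakening-ext : ∀ {Γ Δ υ} → Weakening Γ Δ → Weakening (υ ∷ Γ) (υ ∷ Δ)
  Weakening-ext W = record
    { embed = ext (embed W)
    ; retract = exts (retract W)
    ; retract-embed = λ { here → refl ; (there x) → cong wk (retract-embed W x) }
    ; retract-nominal-free = λ { here c () ; (there y) c oc →
        retract-nominal-free W y c (occ-ren there (retract W y) oc) } }

  Weakening-below : ∀ {Γ υ T} (u : Tm (υ ∷ Γ) T) → NominalFree u →
                    Weakening (υ ∷ Γ) (υ ∷ T ∷ Γ)
  Weakening-below u u-free = record
    { embed = ext there
    ; retract = λ { here → var here ; (there here) → u ; (there (there x)) → var (there x) }
    ; retract-embed = λ { here → refl ; (there x) → refl }
    ; retract-nominal-free = λ { here c () ; (there here) → u-free ; (there (there x)) c () } }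

  InSupp-ren⁻ : ∀ {Γ Δ τ c} (ρ : Ren Γ Δ) (t : Tm Γ τ) → InSupp c (ren ρ t) → InSupp c t
  InSupp-ren⁻ ρ t c∈ t' t≈t' = occ-ren ρ t' (c∈ (ren ρ t') (ren-≈ ρ t≈t'))

  InSupp-ren⁺ : ∀ {Γ Δ τ c} (W : Weakening Γ Δ) (t : Tm Γ τ) →
                InSupp c t → InSupp c (ren (embed W) t)
  InSupp-ren⁺ {c = c} W t c∈ t' ρt≈t' =
    occ-sub (retract W) (λ y → retract-nominal-free W y c) t'
      (c∈ (sub (retract W) t') (≈trans (≡⇒≈ (sym retract-ren)) (sub-≈ (retract W) ρt≈t')))
    where
    retract-ren : sub (retract W) (ren (embed W) t) ≡ t
    retract-ren = trans (sub-ren (retract-embed W) t) (sub-id (λ _ → refl) t)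

  Supp-ren : ∀ {Γ Δ τ} (W : Weakening Γ Δ) {t : Tm Γ τ} {cs : List NC} →
             Supp t cs → Supp (ren (embed W) t) cs
  Supp-ren W {t} (unique , supp) = unique , λ c →
    mk⇔ (InSupp-ren⁺ W t ∘ Equivalence.to (supp c))
        (Equivalence.from (supp c) ∘ InSupp-ren⁻ (embed W) t)

  InSupp-lam : ∀ {Γ σ τ c} (t : Tm (σ ∷ Γ) τ) → InSupp c t ⇔ InSupp c (lam t)
  InSupp-lam {c = c} t = mk⇔ to from
    where
    β-expand : ∀ {t'} → lam t ≈ t' → t ≈ app (wk t') (var here)
    β-expand λt≈t' =
      ≈trans (≡⇒≈ (sym (trans (sub-ren (λ { here → refl ; (there x) → refl }) t) (sub-id (λ _ → refl) t))))
             (≈trans (≈sym (≈β _ _)) (≈app (ren-≈ there λt≈t') ≈refl))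
    to : InSupp c t → InSupp c (lam t)
    to c∈ t' λt≈t' with c∈ (app (wk t') (var here)) (β-expand λt≈t')
    ... | occ-appˡ oc = occ-ren there t' oc
    from : InSupp c (lam t) → InSupp c t
    from c∈ t' t≈t' with c∈ (lam t') (≈lam t≈t')
    ... | occ-lam oc = oc

  Supp-lam : ∀ {Γ σ τ} {t : Tm (σ ∷ Γ) τ} {cs : List NC} → Supp t cs → Supp (lam t) cs
  Supp-lam {t = t} (unique , supp) = unique , λ c →
    mk⇔ (Equivalence.to (InSupp-lam t) ∘ Equivalence.to (supp c))
        (Equivalence.from (supp c) ∘ Equivalence.from (InSupp-lam t))

  map-ren-ext-wk : ∀ {Γ Δ σ} (ρ : Ren Γ Δ) (Φ : List (Fm Γ)) →
                   map (ren (ext {σ = σ} ρ)) (map wk Φ) ≡ map wk (map (ren ρ) Φ)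
  map-ren-ext-wk ρ Φ =
    trans (sym (map-∘ Φ)) (trans (map-cong (ren-ext-wk ρ) Φ) (map-∘ Φ))

  ren-ext-eigeninstance : ∀ {Γ Δ τ σ} (ρ : Ren Γ Δ) (cs : List NC) (M : Tm Γ (τ ⇒ σ)) →
                          ren (ext ρ) (wk M · applyNC cs (var here)) ≡ wk (ren ρ M) · applyNC cs (var here)
  ren-ext-eigeninstance ρ cs M = cong₂ app (ren-ext-wk ρ M) (ren-applyNC (ext ρ) cs (var here))

  ren-sub-∘ : ∀ {Γ Δ Ε τ} (ρ : Ren Δ Ε) (σ : Sub Γ Δ) (t : Tm Γ τ) → ren ρ (sub σ t) ≡ sub (ren ρ ∘ σ) t
  ren-sub-∘ ρ σ = ren-sub (λ _ → refl)

  module Derivations (D : DefSet) where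
    open DefSet D
    open Rules D

    ren-eqL-premises : ∀ {Σ Σ' τ Γ C} (ρ : Ren Σ Σ') (s t : Tm Σ τ) (cs : List NC) →
      (∀ (Σ'' : Ctx) → AllOFree Σ'' → (θ : Sub Σ Σ'') → (∀ {υ} (x : Σ ∋ υ) → NoNom (θ x)) →
         sub θ (abstr cs s) ≈ sub θ (abstr cs t) → Der Σ'' (map (sub θ) Γ) (sub θ C)) →
      (∀ (Σ'' : Ctx) → AllOFree Σ'' → (θ : Sub Σ' Σ'') → (∀ {υ} (x : Σ' ∋ υ) → NoNom (θ x)) →
         sub θ (abstr cs (ren ρ s)) ≈ sub θ (abstr cs (ren ρ t)) →
         Der Σ'' (map (sub θ) (map (ren ρ) Γ)) (sub θ (ren ρ C)))
    ren-eqL-premises {Γ = Γ} {C} ρ s t cs k Σ'' ofree θ θ-nonom s≈t =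
      subst₂ (Der Σ'') (trans (map-cong (sym ∘ sub-ren (λ _ → refl)) Γ) (map-∘ Γ)) (sym (sub-ren (λ _ → refl) C))
        (k Σ'' ofree (θ ∘ ρ) (θ-nonom ∘ ρ) (subst₂ _≈_ (sub-abstr-ren s) (sub-abstr-ren t) s≈t))
      where
      sub-abstr-ren : (r : Tm _ _) → sub θ (abstr cs (ren ρ r)) ≡ sub (θ ∘ ρ) (abstr cs r)
      sub-abstr-ren r = trans (cong (sub θ) (sym (ren-abstr ρ cs r))) (sub-ren (λ _ → refl) (abstr cs r))

    ren-pair : ∀ {Σ Σ'} → Weakening Σ Σ' → List (Fm Σ) × Fm Σ → List (Fm Σ') × Fm Σ'
    ren-pair W = Prod.map (map (ren (embed W))) (ren (embed W))

    mutual
      ren-Der : ∀ {Σ Σ'} (W : Weakening Σ Σ') {Γ C} → Der Σ Γ C →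
                Der Σ' (map (ren (embed W)) Γ) (ren (embed W) C)
      ren-Der W (conv Γ≈ C≈ d) =
        conv (Pointwise.map⁺ _ _ (Pointwise.map (ren-≈ (embed W)) Γ≈)) (ren-≈ (embed W) C≈) (ren-Der W d)
      ren-Der W (exch Γ↭ d) = exch (map⁺ _ Γ↭) (ren-Der W d)
      ren-Der W (idπ {B = B} {B'} π π' e) =
        idπ π π' (subst₂ _≈_ (sym (perm-ren π _ B)) (sym (perm-ren π' _ B')) (ren-≈ (embed W) e))
      ren-Der W (mc ps ds d)   = ren-mc W ps ds d
      ren-Der W (contr d)      = contr (ren-Der W d)
      ren-Der W botL           = botL
      ren-Der W topR           = topR
      ren-Der W (andL₁ d)      = andL₁ (ren-Der W d)
      ren-Der W (andL₂ d)      = andL₂ (ren-Der W d)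
      ren-Der W (andR d d')    = andR (ren-Der W d) (ren-Der W d')
      ren-Der W (orL d d')     = orL (ren-Der W d) (ren-Der W d')
      ren-Der W (orR₁ d)       = orR₁ (ren-Der W d)
      ren-Der W (orR₂ d)       = orR₂ (ren-Der W d)
      ren-Der W (impL d d')    = impL (ren-Der W d) (ren-Der W d')
      ren-Der W (impR d)       = impR (ren-Der W d)
      ren-Der W (allL t d)     = allL (ren (embed W) t) (ren-Der W d)
      ren-Der W (exR t d)      = exR (ren (embed W) t) (ren-Der W d)
      ren-Der W (allR {Γ} {M = M} cs supp d) =
        allR cs (Supp-ren W supp)
          (subst₂ (Der _) (map-ren-ext-wk _ Γ) (ren-ext-eigeninstance _ cs M) (ren-Der (Weakening-ext W) d))
      ren-Der W (exL {Γ} {C} {M = M} cs supp d) =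
        exL cs (Supp-ren W supp)
          (subst₂ (Der _) (cong₂ _∷_ (ren-ext-eigeninstance _ cs M) (map-ren-ext-wk _ Γ)) (ren-ext-wk _ C)
                  (ren-Der (Weakening-ext W) d))
      ren-Der W (nablaL {M = M} a a∉ d) = nablaL a (a∉ ∘ InSupp-ren⁻ (embed W) M) (ren-Der W d)
      ren-Der W (nablaR {M = M} a a∉ d) = nablaR a (a∉ ∘ InSupp-ren⁻ (embed W) M) (ren-Der W d)
      ren-Der W (eqR t) = eqR (ren (embed W) t)
      ren-Der W (eqL {Γ} {C} s t cs supp k) =
        eqL _ _ cs (Supp-ren W supp) (ren-eqL-premises {Γ = Γ} {C} (embed W) s t cs k)
      ren-Der W (defL {Γ} {C} d σ dd) =
        subst (λ H → Der _ (H ∷ map (ren (embed W)) Γ) (ren (embed W) C)) (sym (ren-sub-∘ _ σ (Clause.head (clause d))))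
          (defL d (ren (embed W) ∘ σ)
            (subst (λ B → Der _ (B ∷ map (ren (embed W)) Γ) (ren (embed W) C)) (ren-sub-∘ _ σ (Clause.body (clause d)))
              (ren-Der W dd)))
      ren-Der W (defR {Γ} d σ dd) =
        subst (Der _ (map (ren (embed W)) Γ)) (sym (ren-sub-∘ _ σ (Clause.head (clause d))))
          (defR d (ren (embed W) ∘ σ)
            (subst (Der _ (map (ren (embed W)) Γ)) (ren-sub-∘ _ σ (Clause.body (clause d))) (ren-Der W dd)))
      ren-Der W natR₀     = natR₀
      ren-Der W (natRs d) = natRs (ren-Der W d)
      ren-Der W (natL {Γ} {C} {I} Dn d₀ dₛ d) =
        natL Dn d₀ dₛ
          (subst (λ Dn' → Der _ (app Dn' (ren (embed W) I) ∷ map (ren (embed W)) Γ) (ren (embed W) C))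
                 (ren-ren (λ ()) Dn) (ren-Der W d))

      ren-mc : ∀ {Σ Σ'} (W : Weakening Σ Σ') {Γ C} (ps : List (List (Fm Σ) × Fm Σ)) →
               All (λ { (Δ , B) → Der Σ Δ B }) ps →
               Der Σ (map proj₂ ps ++ Γ) C →
               Der Σ' (map (ren (embed W)) (concat (map proj₁ ps) ++ Γ)) (ren (embed W) C)
      ren-mc W {Γ} {C} ps ds d =
        subst (λ Φ → Der _ Φ (ren (embed W) C)) (sym (map-concat-proj₁-++ (ren (embed W)) ps Γ))
          (mc (map (ren-pair W) ps) (ren-All W ps ds)
            (subst (λ Φ → Der _ Φ (ren (embed W) C)) (map-proj₂-++ (ren (embed W)) ps Γ) (ren-Der W d)))

      ren-All : ∀ {Σ Σ'} (W : Weakening Σ Σ') (ps : List (List (Fm Σ) × Fm Σ)) →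
                All (λ { (Δ , B) → Der Σ Δ B }) ps →
                All (λ { (Δ , B) → Der Σ' Δ B }) (map (ren-pair W) ps)
      ren-All W []       []       = []
      ren-All W (_ ∷ ps) (d ∷ ds) = ren-Der W d ∷ ren-All W ps ds

    cut : ∀ {Σ A B Γ C} → Der Σ (A ∷ []) B → Der Σ (B ∷ Γ) C → Der Σ (A ∷ Γ) C
    cut A⊢B B⊢C = mc ((_ ∷ [] , _) ∷ []) (A⊢B ∷ []) B⊢C

    ex-instance : ∀ {Σ Γ τ p B} {M : Tm Σ (τ ⇒ o)} (t : Tm Σ τ) → B ≈ (M · t) →
                  Der Σ (B ∷ Γ) (ex τ p · M)
    ex-instance {B = B} t B≈Mt =
      exR t (idπ idPerm idPerm (subst₂ _≈_ (sym (perm-id B)) (sym (perm-id _)) B≈Mt))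

  var-nominal-free : ∀ {Γ τ} (x : Γ ∋ τ) → NominalFree (var x)
  var-nominal-free x c ()

  abstrVacuous : ∀ {Γ τ} (ds : List NC) → Tm Γ τ → Tm Γ (raise ds τ)
  abstrVacuous []             u = u
  abstrVacuous ((i , n) ∷ ds) u = lam (abstrVacuous ds (wk u))

  abstrPadded : ∀ {Γ τ} (as cs : List NC) → Tm Γ (raise as τ) → Tm Γ (raise (as ++ cs) τ)
  abstrPadded []             cs u = abstrVacuous cs u
  abstrPadded ((i , n) ∷ as) cs u = lam (abstrPadded as cs (app (wk u) (var here)))

  wk-nominal-free : ∀ {Γ σ τ} {u : Tm Γ τ} → NominalFree u → NominalFree (wk {σ = σ} u)
  wk-nominal-free {u = u} u-free c = u-free c ∘ occ-ren there u

  abstrVacuous-nominal-free : ∀ {Γ τ} (ds : List NC) {u : Tm Γ τ} →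
                              NominalFree u → NominalFree (abstrVacuous ds u)
  abstrVacuous-nominal-free []             u-free = u-free
  abstrVacuous-nominal-free ((i , n) ∷ ds) u-free c (occ-lam oc) =
    abstrVacuous-nominal-free ds (wk-nominal-free u-free) c oc

  abstrPadded-nominal-free : ∀ {Γ τ} (as cs : List NC) {u : Tm Γ (raise as τ)} →
                             NominalFree u → NominalFree (abstrPadded as cs u)
  abstrPadded-nominal-free []             cs u-free = abstrVacuous-nominal-free cs u-free
  abstrPadded-nominal-free ((i , n) ∷ as) cs {u} u-free c (occ-lam oc) =
    abstrPadded-nominal-free as cs uvar-free c oc
    where
    uvar-free : NominalFree (app (wk u) (var here))
    uvar-free c (occ-appˡ oc) = wk-nominal-free u-free c oc

  ren-ext-inst : ∀ {Σ Σ' τ σ} (ρ : Ren Σ Σ') (cs : List NC) (B : Tm (τ ∷ Σ) σ) →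
                 ren (ext ρ) (inst cs B) ≡ inst cs (ren (ext ρ) B)
  ren-ext-inst ρ cs B = trans (ren-sub (λ _ → refl) B) (sym (sub-ren instSub-ext B))
    where
    instSub-ext : ∀ {υ} (x : _ ∋ υ) → instSub cs (ext ρ x) ≡ ren (ext ρ) (instSub cs x)
    instSub-ext here      = sym (ren-applyNC (ext ρ) cs (var here))
    instSub-ext (there x) = refl

  inst≈β : ∀ {Σ τ σ} (cs : List NC) (B : Tm (τ ∷ Σ) σ) →
           inst cs B ≈ (lam (ren (ext there) B) · applyNC cs (var here))
  inst≈β cs B = ≈sym (≈trans (≈β _ _) (≡⇒≈ (sub-ren (λ { here → refl ; (there x) → refl }) B)))

lemma9 : (S : Sig) → let open LG S in (D : DefSet) → let open Rules D in
    ∀ (Σ : Ctx) (τ : Ty) → OFree τ → AllOFree Σ →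
    (B : Fm (τ ∷ Σ)) (Γ : List (Fm Σ)) (C : Fm Σ) →
    (as : List NC) → Supp B as →
    (cs : List NC) → All (λ c → ¬ InSupp c B) cs →
    Der (raise as τ ∷ Σ) (inst as B ∷ map wk Γ) (wk C) →
    Der (raise (as ++ cs) τ ∷ Σ) (inst (as ++ cs) B ∷ map wk Γ) (wk C)
lemma9 S D Σ τ p _ B Γ C as supp cs _ Π = cut B⊢∃B (exL as supp-∃B Π⁺)
  where
  open LG S
  open Rules D
  open Metatheory S
  open Derivations D
  ∃B-body : Tm (raise (as ++ cs) τ ∷ Σ) (τ ⇒ o)
  ∃B-body = lam (ren (ext there) B)
  B⊢∃B : Der _ (inst (as ++ cs) B ∷ []) (ex τ p · ∃B-body)
  B⊢∃B = ex-instance (applyNC (as ++ cs) (var here)) (inst≈β (as ++ cs) B)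
  supp-∃B : Supp ∃B-body as
  supp-∃B = Supp-lam (Supp-ren (Weakening-below (abstrVacuous (as ++ cs) (var here))
                                                (abstrVacuous-nominal-free (as ++ cs) (var-nominal-free here)))
                               supp)
  head≈ : ren (ext there) (inst as B) ≈ (wk ∃B-body · applyNC as (var here))
  head≈ = ≈trans (≡⇒≈ (ren-ext-inst there as B)) (inst≈β as (ren (ext there) B))
  Π⁺ : Der (raise as τ ∷ raise (as ++ cs) τ ∷ Σ)
           (wk ∃B-body · applyNC as (var here) ∷ map wk (map wk Γ)) (wk (wk C))
  Π⁺ = conv (head≈ ∷ Pointwise.refl ≈refl) ≈refl
         (subst₂ (Der _) (cong (_ ∷_) (map-ren-ext-wk there Γ)) (ren-ext-wk there C)
           (ren-Der (Weakening-below (abstrPadded as cs (var here))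
                                     (abstrPadded-nominal-free as cs (var-nominal-free here)))
                    Π))
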